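{- Let $\mathrm{m}$ be a bipartite planar map and let $d\geq \Delta_\circ(\mathrm{m})$, where $\Delta_\circ(\mathrm{m})$ is the maximal degree of a white vertex. In any $\alpha_d$-orientation $\mathcal{O}$ of $\mathrm{m}$, every saturated edge is oriented from its black endpoint to its white endpoint; that is, if $e=\{h_\bullet,h_\circ\}$ is an edge with one of its half-edges of value $0$, then $\mathcal{O}(h_\circ)=0$ (and $\mathcal{O}(h_\bullet)=d+1$), where $h_\circ$, $h_\bullet$ are the half-edges of $e$ at its white and black endpoints.
   Context: Bipartite maps carry a fixed proper black/white vertex coloring. A $k$-fractional orientation of a map is a function $\mathcal{O}$ from the set of half-edges to $\mathbb{Z}_{\ge0}$ such that $\mathcal{O}(h_1)+\mathcal{O}(h_2)=k$ for every edge $\{h_1,h_2\}$. The outdegree of a vertex $v$ is $\sum_{h\text{ incident to }v}\mathcal{O}(h)$. A directed edge $(h_1,h_2)$ (from the endpoint of $h_1$ to that of $h_2$) is saturated if $\mathcal{O}(h_2)=0$. For $d\ge1$, an $\alpha_d$-orientation is a $(d+1)$-fractional orientation in which every black vertex $v$ has outdegree $d\deg(v)$ and every white vertex $v$ has outdegree $\deg(v)$. -}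

module Defs where

open import Data.Nat using (ℕ; zero; suc; _+_; _*_; _≤_)
open import Data.Fin using (Fin; zero; suc; toℕ) renaming (_≤_ to _≤ᶠ_)
open import Data.Fin.Properties using (any?; all?) renaming (_≟_ to _≟ᶠ_; _≤?_ to _≤ᶠ?_)
open import Data.Fin.Permutation using (Permutation′; _⟨$⟩ʳ_)
open import Data.Product using (∃; _,_; _×_)
open import Relation.Binary.PropositionalEquality using (_≡_; _≢_)
open import Relation.Nullary using (Dec; yes; no)

sumFin : ∀ {n} → (Fin n → ℕ) → ℕ
sumFin {zero}  f = 0
sumFin {suc n} f = f zero + sumFin (λ i → f (suc i))

indicator : ∀ {p} {P : Set p} → Dec P → ℕ
indicator (yes _) = 1
indicator (no _)  = 0

iter : ∀ {A : Set} → (A → A) → ℕ → A → A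
iter f zero    x = x
iter f (suc k) x = f (iter f k x)

-- h' lies in the orbit of h under π (an orbit of a permutation of
-- Fin n has size ≤ n, so exponents < n suffice).
InOrbit : ∀ {n} → Permutation′ n → Fin n → Fin n → Set
InOrbit {n} π h h' = ∃ λ (k : Fin n) → iter (π ⟨$⟩ʳ_) (toℕ k) h ≡ h'

inOrbit? : ∀ {n} (π : Permutation′ n) (h h' : Fin n) → Dec (InOrbit π h h')
inOrbit? π h h' = any? (λ k → iter (π ⟨$⟩ʳ_) (toℕ k) h ≟ᶠ h')

orbitSize : ∀ {n} → Permutation′ n → Fin n → ℕ
orbitSize π h = sumFin (λ h' → indicator (inOrbit? π h h'))

orbitSum : ∀ {n} → Permutation′ n → (Fin n → ℕ) → Fin n → ℕ
orbitSum π w h = sumFin (λ h' → indicator' (inOrbit? π h h') (w h'))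
  where
  indicator' : ∀ {p} {P : Set p} → Dec P → ℕ → ℕ
  indicator' (yes _) m = m
  indicator' (no _)  m = 0

IsRep : ∀ {n} → (Fin n → Fin n) → Fin n → Set
IsRep {n} f h = ∀ (k : Fin n) → h ≤ᶠ iter f (toℕ k) h

isRep? : ∀ {n} (f : Fin n → Fin n) (h : Fin n) → Dec (IsRep f h)
isRep? {n} f h = all? {n} (λ k → h ≤ᶠ? iter f (toℕ k) h)

numOrbits : ∀ {n} → (Fin n → Fin n) → ℕ
numOrbits f = sumFin (λ h → indicator (isRep? f h))

data Reach {n} (σ α : Permutation′ n) (h : Fin n) : Fin n → Set where
  here  : Reach σ α h h
  stepσ : ∀ {h'} → Reach σ α h h' → Reach σ α h (σ ⟨$⟩ʳ h')
  stepα : ∀ {h'} → Reach σ α h h' → Reach σ α h (α ⟨$⟩ʳ h')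

-- A (connected, combinatorial) map on the half-edge set Fin n:
-- σ gives the cyclic order of half-edges around vertices (vertices =
-- σ-orbits), α is a fixed-point-free involution (edges = α-orbits),
-- faces are the orbits of φ = σ ∘ α.
record Map (n : ℕ) : Set where
  field
    σ α        : Permutation′ n
    α-invol    : ∀ h → α ⟨$⟩ʳ (α ⟨$⟩ʳ h) ≡ h
    α-noFix    : ∀ h → α ⟨$⟩ʳ h ≢ h
    connected  : ∀ h h' → Reach σ α h h'

  φ : Fin n → Fin n
  φ h = σ ⟨$⟩ʳ (α ⟨$⟩ʳ h)

  numVertices : ℕ
  numVertices = numOrbits (σ ⟨$⟩ʳ_)

  numEdges : ℕ
  numEdges = numOrbits (α ⟨$⟩ʳ_)

  numFaces : ℕ
  numFaces = numOrbits φ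

  deg : Fin n → ℕ
  deg h = orbitSize σ h

-- Planar map: genus 0, i.e. Euler's formula V - E + F = 2.
Planar : ∀ {n} → Map n → Set
Planar m = numVertices + numFaces ≡ numEdges + 2
  where open Map m

data Colour : Set where
  black white : Colour

-- A fixed proper black/white vertex colouring, recorded on half-edges:
-- constant around each vertex, different at the two ends of each edge.
record BipartiteMap (n : ℕ) : Set where
  field
    map       : Map n
  open Map map public
  field
    colour    : Fin n → Colour
    colour-σ  : ∀ h → colour (σ ⟨$⟩ʳ h) ≡ colour h
    colour-α  : ∀ h → colour (α ⟨$⟩ʳ h) ≢ colour h

  outdeg : (Fin n → ℕ) → Fin n → ℕ
  outdeg O h = orbitSum σ O h

  WhiteDegBound : ℕ → Set
  WhiteDegBound d = ∀ h → colour h ≡ white → deg h ≤ d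

  IsFracOrientation : ℕ → (Fin n → ℕ) → Set
  IsFracOrientation k O = ∀ h → O h + O (α ⟨$⟩ʳ h) ≡ k

  IsAlphaOrientation : ℕ → (Fin n → ℕ) → Set
  IsAlphaOrientation d O =
    IsFracOrientation (suc d) O
    × (∀ h → colour h ≡ black → outdeg O h ≡ d * deg h)
    × (∀ h → colour h ≡ white → outdeg O h ≡ deg h)

{-# OPTIONS --safe #-}
-- A white vertex has outdegree deg ≤ d, so none of its half-edges carries
-- the value d + 1; the half-edge of value 0 on a saturated edge is
-- therefore the white one.
module Submission where

open import Defs
open import Data.Nat using (ℕ; suc; _≤_; _+_)
open import Data.Nat.Properties using (≤-trans; m≤m+n; m≤n+m; +-identityʳ; 1+n≰n; module ≤-Reasoning)
open import Data.Fin using (Fin; zero; suc)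
open import Data.Fin.Permutation using (Permutation′; _⟨$⟩ʳ_)
open import Data.Product using (∃; _×_; _,_; proj₁)
open import Data.Sum using (_⊎_; inj₁; inj₂)
open import Relation.Binary.PropositionalEquality using (_≡_; refl; sym; trans; cong; subst; module ≡-Reasoning)
open import Relation.Nullary using (yes; no; contradiction)
open import Data.Empty using (⊥-elim)

≤-sumFin : ∀ {n} (f : Fin n → ℕ) (i : Fin n) → f i ≤ sumFin f
≤-sumFin f zero    = m≤m+n _ _
≤-sumFin f (suc i) = ≤-trans (≤-sumFin (λ j → f (suc j)) i) (m≤n+m _ _)

inOrbit-refl : ∀ {n} (π : Permutation′ n) (h : Fin n) → InOrbit π h h
inOrbit-refl {suc n} π h = zero , refl

-- The summands of `orbitSum` are built by a helper local to its definition;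
-- this gives them a name.
orbitSum-as-sumFin : ∀ {n} (π : Permutation′ n) (w : Fin n → ℕ) (h : Fin n) →
                     ∃ λ (f : Fin n → ℕ) → orbitSum π w h ≡ sumFin f
orbitSum-as-sumFin π w h = _ , refl

orbitSum-summand-self : ∀ {n} (π : Permutation′ n) (w : Fin n → ℕ) (h : Fin n) →
                        proj₁ (orbitSum-as-sumFin π w h) h ≡ w h
orbitSum-summand-self π w h with inOrbit? π h h
... | yes _     = refl
... | no ¬h∈πh = contradiction (inOrbit-refl π h) ¬h∈πh

≤-orbitSum : ∀ {n} (π : Permutation′ n) (w : Fin n → ℕ) (h : Fin n) → w h ≤ orbitSum π w h
≤-orbitSum π w h = subst (_≤ orbitSum π w h) (orbitSum-summand-self π w h) (≤-sumFin _ h)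

module _ {n} (m : BipartiteMap n) where
  open BipartiteMap m

  fracOrientation-partnerZero⇒full : ∀ {k} O → IsFracOrientation k O →
                                     ∀ h → O (α ⟨$⟩ʳ h) ≡ 0 → O h ≡ k
  fracOrientation-partnerZero⇒full {k} O frac h Oαh≡0 = begin
    O h                 ≡⟨ sym (+-identityʳ (O h)) ⟩
    O h + 0             ≡⟨ cong (O h +_) (sym Oαh≡0) ⟩
    O h + O (α ⟨$⟩ʳ h)  ≡⟨ frac h ⟩
    k                   ∎
    where open ≡-Reasoning

  fracOrientation-zero⇒partnerFull : ∀ {k} O → IsFracOrientation k O →
                                     ∀ h → O h ≡ 0 → O (α ⟨$⟩ʳ h) ≡ k
  fracOrientation-zero⇒partnerFull O frac h Oh≡0 =
    trans (cong (_+ O (α ⟨$⟩ʳ h)) (sym Oh≡0)) (frac h)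

  ≤-outdeg : ∀ O h → O h ≤ outdeg O h
  ≤-outdeg O = ≤-orbitSum σ O

  whiteHalfEdge-≤ : ∀ {d O} → WhiteDegBound d →
                    (∀ h → colour h ≡ white → outdeg O h ≡ deg h) →
                    ∀ h → colour h ≡ white → O h ≤ d
  whiteHalfEdge-≤ {d} {O} deg≤d outdeg≡deg h h-white =
    begin
      O h         ≤⟨ ≤-outdeg O h ⟩
      outdeg O h  ≡⟨ outdeg≡deg h h-white ⟩
      deg h       ≤⟨ deg≤d h h-white ⟩
      d           ∎
    where open ≤-Reasoning

mainTheorem4 : ∀ {n} (m : BipartiteMap n) → Planar (BipartiteMap.map m)
    → (d : ℕ) → 1 ≤ d → BipartiteMap.WhiteDegBound m d
    → (O : Fin n → ℕ) → BipartiteMap.IsAlphaOrientation m d O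
    → ∀ (h : Fin n) → BipartiteMap.colour m h ≡ white
    → (O h ≡ 0 ⊎ O (BipartiteMap.α m ⟨$⟩ʳ h) ≡ 0)
    → O h ≡ 0 × O (BipartiteMap.α m ⟨$⟩ʳ h) ≡ suc d
mainTheorem4 m _ _ _ _ O (frac , _ , _) h _ (inj₁ Oh≡0) =
  Oh≡0 , fracOrientation-zero⇒partnerFull m O frac h Oh≡0
mainTheorem4 m _ d _ deg≤d O (frac , _ , outdeg≡deg) h h-white (inj₂ Oαh≡0) =
  ⊥-elim (1+n≰n (subst (_≤ d) Oh≡1+d (whiteHalfEdge-≤ m deg≤d outdeg≡deg h h-white)))
  where
  Oh≡1+d : O h ≡ suc d
  Oh≡1+d = fracOrientation-partnerZero⇒full m O frac h Oαh≡0
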